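{- For all matches $(p,\sigma)$, $(q,\rho)$ of CPC patterns, if $p,\sigma\bowtie q,\rho$ then ${\sf fn}(p)={\sf fn}(q)$, ${\sf vn}(p)\subseteq{\sf vn}(q)$ and ${\sf pn}(q)\subseteq{\sf pn}(p)$.
   Context: Patterns: $p ::= \lambda x \mid x \mid \ulcorner x\urcorner \mid p\bullet p$ (binding, variable, protected name, compound); ${\sf vn},{\sf pn},{\sf bn}$ are variable, protected, binding names, ${\sf fn}={\sf vn}\cup{\sf pn}$; patterns are well formed (binding names distinct, disjoint from free names). Communicable patterns contain no protected or binding names. A substitution is a finite-domain partial map from names to communicable patterns. $\hat\sigma$: $\hat\sigma x=x$, $\hat\sigma\ulcorner x\urcorner=\ulcorner x\urcorner$, $\hat\sigma(\lambda x)=\sigma(x)$ if $x\in{\sf dom}(\sigma)$ else $\lambda x$, $\hat\sigma(p\bullet q)=\hat\sigma p\bullet\hat\sigma q$. A match $(p,\sigma)$: ${\sf bn}(p)={\sf dom}(\sigma)$. Compatibility $p,\sigma\bowtie q,\rho$: $p,\sigma\bowtie\lambda y,\{\hat\sigma p/y\}$ if ${\sf fn}(p)=\emptyset$; $n,\{\}\bowtie n,\{\}$; $\ulcorner n\urcorner,\{\}\bowtie\ulcorner n\urcorner,\{\}$; $\ulcorner n\urcorner,\{\}\bowtie n,\{\}$; $p_1\bullet p_2,\sigma_1\cup\sigma_2\bowtie q_1\bullet q_2,\rho_1\cup\rho_2$ if $p_i,\sigma_i\bowtie q_i,\rho_i$ for $i=1,2$. -}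

module Defs where

open import Data.Nat using (ℕ; _≟_)
open import Data.List using (List; []; _∷_; _++_; map)
open import Data.List.Relation.Unary.All using (All)
open import Data.List.Relation.Unary.Unique.Propositional using (Unique)
open import Data.List.Relation.Binary.Subset.Propositional using (_⊆_)
open import Data.List.Membership.Propositional using (_∈_)
open import Data.Product using (_×_; _,_; proj₁; proj₂)
open import Relation.Nullary using (¬_; yes; no)
open import Relation.Binary.PropositionalEquality using (_≡_)

-- Names are natural numbers (any countable set with decidable equality).
Name : Set
Name = ℕ

-- CPC patterns:  λx | x | ⌜x⌝ | p • q
data Pattern : Set where
  bind : Name → Pattern
  var  : Name → Pattern
  prot : Name → Pattern
  _•_  : Pattern → Pattern → Pattern

infixr 5 _•_

-- variable, protected and binding names (as lists, read as sets)
vn : Pattern → List Name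
vn (bind x) = []
vn (var x)  = x ∷ []
vn (prot x) = []
vn (p • q)  = vn p ++ vn q

pn : Pattern → List Name
pn (bind x) = []
pn (var x)  = []
pn (prot x) = x ∷ []
pn (p • q)  = pn p ++ pn q

bn : Pattern → List Name
bn (bind x) = x ∷ []
bn (var x)  = []
bn (prot x) = []
bn (p • q)  = bn p ++ bn q

fn : Pattern → List Name
fn p = vn p ++ pn p

_≈ₛ_ : List Name → List Name → Set
xs ≈ₛ ys = (xs ⊆ ys) × (ys ⊆ xs)

WellFormed : Pattern → Set
WellFormed p = Unique (bn p) × (∀ {x} → x ∈ bn p → ¬ (x ∈ fn p))

Communicable : Pattern → Set
Communicable p = (pn p ≡ []) × (bn p ≡ [])

-- substitutions: finite partial maps, represented as association lists
Subst : Set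
Subst = List (Name × Pattern)

dom : Subst → List Name
dom σ = map proj₁ σ

IsSubst : Subst → Set
IsSubst σ = Unique (dom σ) × All (λ b → Communicable (proj₂ b)) σ

lookupS : Subst → Name → Pattern
lookupS [] x = bind x
lookupS ((y , v) ∷ σ) x with x ≟ y
... | yes _ = v
... | no  _ = lookupS σ x

apply : Subst → Pattern → Pattern
apply σ (bind x) = lookupS σ x
apply σ (var x)  = var x
apply σ (prot x) = prot x
apply σ (p • q)  = apply σ p • apply σ q

Match : Pattern → Subst → Set
Match p σ = IsSubst σ × (bn p ≈ₛ dom σ)

-- compatibility  p,σ ⋈ q,ρ   (union of substitutions = concatenation;
-- in the compound rule the domains are disjoint for matches)
data _,_⋈_,_ : Pattern → Subst → Pattern → Subst → Set where
  ⋈-bind : ∀ {p σ y} → fn p ≡ [] → p , σ ⋈ bind y , ((y , apply σ p) ∷ [])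
  ⋈-var  : ∀ {n} → var n , [] ⋈ var n , []
  ⋈-prot : ∀ {n} → prot n , [] ⋈ prot n , []
  ⋈-pv   : ∀ {n} → prot n , [] ⋈ var n , []
  ⋈-comp : ∀ {p₁ p₂ q₁ q₂ σ₁ σ₂ ρ₁ ρ₂} →
           p₁ , σ₁ ⋈ q₁ , ρ₁ → p₂ , σ₂ ⋈ q₂ , ρ₂ →
           (p₁ • p₂) , (σ₁ ++ σ₂) ⋈ (q₁ • q₂) , (ρ₁ ++ ρ₂)

module Submission where

-- Compatibility p,σ ⋈ q,ρ never invents or loses free names: the free names
-- of the two sides coincide, and the only way a name can change its role is
-- the rule ⌜n⌝ ⋈ n, which turns a protected name on the left into a variable
-- name on the right.  Hence variable names flow from p to q and protected
-- names flow from q to p.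
--
-- For vn and pn the compound
-- case is just monotonicity of list concatenation, since vn and pn of a
-- compound pattern are the concatenations of those of its parts.  For fn
-- this is not literally so — fn (p • q) lists the variable names of both
-- parts before their protected names — so we first show that the
-- "middle-four interchange" of list concatenation preserves the underlying
-- set (++-interchange), which gives fn (p • q) ≈ₛ fn p ++ fn q.

open import Defs
open import Data.Product using (_×_; _,_)
open import Data.Sum using ([_,_]′)
open import Data.List using (List; []; _++_)
open import Data.List.Membership.Propositional.Properties using (∈-++⁻)
open import Data.List.Relation.Binary.Subset.Propositional using (_⊆_)
open import Data.List.Relation.Binary.Subset.Propositional.Properties
  using (⊆-reflexive; ⊆-trans; xs⊆xs++ys; xs⊆ys++xs; ++⁺)
open import Relation.Binary.PropositionalEquality using (_≡_; sym)

private
  variable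
    A : Set
    xs ys zs : List A

++-⊆-lub : xs ⊆ zs → ys ⊆ zs → xs ++ ys ⊆ zs
++-⊆-lub {xs = xs} xs⊆zs ys⊆zs x∈xs++ys = [ xs⊆zs , ys⊆zs ]′ (∈-++⁻ xs x∈xs++ys)

++-interchange : (a b c d : List A) → (a ++ b) ++ (c ++ d) ⊆ (a ++ c) ++ (b ++ d)
++-interchange a b c d =
  ++-⊆-lub (++⁺ (xs⊆xs++ys a c) (xs⊆xs++ys b d))
           (++⁺ (xs⊆ys++xs c a) (xs⊆ys++xs d b))

fn-•⁻ : (p q : Pattern) → fn (p • q) ⊆ fn p ++ fn q
fn-•⁻ p q = ++-interchange (vn p) (vn q) (pn p) (pn q)

fn-•⁺ : (p q : Pattern) → fn p ++ fn q ⊆ fn (p • q)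
fn-•⁺ p q = ++-interchange (vn p) (pn p) (vn q) (pn q)

++-≈ₛ : ∀ {xs xs′ ys ys′} → xs ≈ₛ xs′ → ys ≈ₛ ys′ → (xs ++ ys) ≈ₛ (xs′ ++ ys′)
++-≈ₛ (xs⊆xs′ , xs′⊆xs) (ys⊆ys′ , ys′⊆ys) = ++⁺ xs⊆xs′ ys⊆ys′ , ++⁺ xs′⊆xs ys′⊆ys

vn-closed : (p : Pattern) → fn p ≡ [] → vn p ⊆ []
vn-closed p closed = ⊆-trans (xs⊆xs++ys (vn p) (pn p)) (⊆-reflexive closed)

⋈-vn : ∀ {p σ q ρ} → p , σ ⋈ q , ρ → vn p ⊆ vn q
⋈-vn {p} (⋈-bind closed) = vn-closed p closed
⋈-vn ⋈-var               = λ n∈ → n∈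
⋈-vn ⋈-prot              = λ ()
⋈-vn ⋈-pv                = λ ()
⋈-vn (⋈-comp d₁ d₂)      = ++⁺ (⋈-vn d₁) (⋈-vn d₂)

⋈-pn : ∀ {p σ q ρ} → p , σ ⋈ q , ρ → pn q ⊆ pn p
⋈-pn (⋈-bind _)     = λ ()
⋈-pn ⋈-var          = λ ()
⋈-pn ⋈-prot         = λ n∈ → n∈
⋈-pn ⋈-pv           = λ ()
⋈-pn (⋈-comp d₁ d₂) = ++⁺ (⋈-pn d₁) (⋈-pn d₂)

⋈-fn : ∀ {p σ q ρ} → p , σ ⋈ q , ρ → fn p ≈ₛ fn q
⋈-fn (⋈-bind closed) = ⊆-reflexive closed , ⊆-reflexive (sym closed)
⋈-fn ⋈-var           = (λ n∈ → n∈) , (λ n∈ → n∈)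
⋈-fn ⋈-prot          = (λ n∈ → n∈) , (λ n∈ → n∈)
⋈-fn ⋈-pv            = (λ n∈ → n∈) , (λ n∈ → n∈)
⋈-fn (⋈-comp {p₁} {p₂} {q₁} {q₂} d₁ d₂) with ++-≈ₛ (⋈-fn d₁) (⋈-fn d₂)
... | p⊆q , q⊆p = ⊆-trans (fn-•⁻ p₁ p₂) (⊆-trans p⊆q (fn-•⁺ q₁ q₂))
                , ⊆-trans (fn-•⁻ q₁ q₂) (⊆-trans q⊆p (fn-•⁺ p₁ p₂))

lemma3p13 : (p q : Pattern) (σ ρ : Subst) →
    WellFormed p → WellFormed q → Match p σ → Match q ρ →
    p , σ ⋈ q , ρ →
    (fn p ≈ₛ fn q) × (vn p ⊆ vn q) × (pn q ⊆ pn p)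
lemma3p13 _ _ _ _ _ _ _ _ compatible = ⋈-fn compatible , ⋈-vn compatible , ⋈-pn compatible
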